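{- Let $P$ be a finite $(3+1)$-free poset on a set $V$, let $a,b,c,d$ induce a $(2+2)$ subposet of $P$ with $a<_Pc$, $b<_Pd$, and let $(V_1,V_2)$ be a pair of subsets of $V$ that is maximal with respect to inclusion among pairs satisfying conditions (a)–(e) below. Write $V_1=\{v_1,\dots,v_m\}$, $V_2=\{w_1,\dots,w_n\}$ and let $k\in\{0,1,\dots,m\}$. Define the relation $<_Q$ on $V$ by: if at least one of $x,y$ lies outside $V_1\cup V_2$, then $x<_Qy$ iff $x<_Py$; no two elements of $V_1$ are $<_Q$-related, and no two elements of $V_2$ are; for $v_i\in V_1$, $w_j\in V_2$, $v_i<_Qw_j$ iff $i>k$, and never $w_j<_Qv_i$. (Then $Q=(V,<_Q)$ is a poset whose incomparability graph is obtained from that of $P$ by replacing the induced subgraph on $V_1\cup V_2$ by two cliques on $V_1$ and $V_2$ plus all edges $v_iw_j$ with $i\le k$.) Then the number of $4$-element subsets $X\subseteq V$ such that $Q|_X$ is an induced $(2+2)$ poset is strictly smaller than the number of $4$-element subsets $X$ such that $P|_X$ is an induced $(2+2)$ poset. Conditions: (a) $a,b\in V_1$, $c,d\in V_2$; (b) elements of $V_1$ are pairwise $P$-incomparable, and elements of $V_2$ are pairwise $P$-incomparable; (c) for every nonempty $A\subsetneq V_1$ there is an induced $(2+2)$ subposet of $P$ with one element in $A$, one in $V_1\setminus A$, two in $V_2$; (d) for every nonempty $B\subsetneq V_2$ there is an induced $(2+2)$ subposet of $P$ with one element in $B$, one in $V_2\setminus B$, two in $V_1$; (e) for all $x\in V_1$,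 $y\in V_2$, either $x<_Py$ or $x,y$ are $P$-incomparable.
   Context: The $(3+1)$ poset has elements $a,b,c,d$ with $a<b<c$ and $d$ incomparable to the others; the $(2+2)$ poset has $a<c$, $b<d$ and no other strict relations. A poset is $Q$-free if it has no induced subposet isomorphic to $Q$. The incomparability graph of a poset is the simple graph on its elements with two distinct elements adjacent iff they are incomparable. "Maximal with respect to inclusion" means no other pair $(V_1',V_2')$ satisfying (a)–(e) has $V_1\subseteq V_1'$ and $V_2\subseteq V_2'$. -}

module Defs where

open import Data.Nat using (ℕ; zero; suc; _≤_; _≤?_; _≟_)
open import Data.Fin using (Fin; toℕ)
open import Data.Fin.Properties using (any?) renaming (_≟_ to _≟ᶠ_)
open import Data.Fin.Subset using (Subset; _∈_; _∉_; _⊆_; ∣_∣; Nonempty; inside; outside)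
open import Data.Fin.Subset.Properties using (_∈?_)
open import Data.Vec using ([]; _∷_)
open import Data.List using (List; []; _∷_; _++_; map; length; filter)
open import Data.Product using (Σ; ∃; ∃₂; _×_; _,_)
open import Data.Sum using (_⊎_)
open import Relation.Nullary using (¬_; Dec; yes; no)
open import Relation.Nullary.Decidable using (_×-dec_; _⊎-dec_; ¬?; map′)
open import Relation.Binary.PropositionalEquality using (_≡_; _≢_)
open import Function using (_⇔_)
open import Function.Definitions using (Injective)

BinRel : ℕ → Set₁
BinRel N = Fin N → Fin N → Set

DecRel : {N : ℕ} → BinRel N → Set
DecRel {N} R = (x y : Fin N) → Dec (R x y)

Incomp : {N : ℕ} → BinRel N → Fin N → Fin N → Set
Incomp R x y = x ≢ y × ¬ R x y × ¬ R y x

IsInduced22 : {N : ℕ} → BinRel N → Fin N → Fin N → Fin N → Fin N → Set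
IsInduced22 R a b c d =
  a ≢ c × b ≢ d × R a c × R b d ×
  Incomp R a b × Incomp R a d × Incomp R c b × Incomp R c d

ThreeOneFree : {N : ℕ} → BinRel N → Set
ThreeOneFree {N} R = ¬ (Σ (Fin N) λ a → Σ (Fin N) λ b → Σ (Fin N) λ c → Σ (Fin N) λ d →
  R a b × R b c × Incomp R a d × Incomp R b d × Incomp R c d)

OneOf4 : {N : ℕ} → Fin N → Fin N → Fin N → Fin N → Fin N → Set
OneOf4 z x₁ x₂ x₃ x₄ = z ≡ x₁ ⊎ z ≡ x₂ ⊎ z ≡ x₃ ⊎ z ≡ x₄

Induced22On4 : {N : ℕ} → BinRel N → Fin N → Fin N → Fin N → Fin N → Set
Induced22On4 {N} R x₁ x₂ x₃ x₄ =
  Σ (Fin N) λ a → Σ (Fin N) λ b → Σ (Fin N) λ c → Σ (Fin N) λ d →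
  OneOf4 a x₁ x₂ x₃ x₄ × OneOf4 b x₁ x₂ x₃ x₄ × OneOf4 c x₁ x₂ x₃ x₄ × OneOf4 d x₁ x₂ x₃ x₄ ×
  IsInduced22 R a b c d

-- the subset X induces a (2+2) subposet (together with ∣ X ∣ ≡ 4 this says R|_X ≅ 2+2)
Induced22On : {N : ℕ} → BinRel N → Subset N → Set
Induced22On {N} R X =
  Σ (Fin N) λ a → Σ (Fin N) λ b → Σ (Fin N) λ c → Σ (Fin N) λ d →
  a ∈ X × b ∈ X × c ∈ X × d ∈ X × IsInduced22 R a b c d

incomp? : {N : ℕ} {R : BinRel N} → DecRel R → (x y : Fin N) → Dec (Incomp R x y)
incomp? R? x y = ¬? (x ≟ᶠ y) ×-dec ¬? (R? x y) ×-dec ¬? (R? y x)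

induced22? : {N : ℕ} {R : BinRel N} → DecRel R → (a b c d : Fin N) → Dec (IsInduced22 R a b c d)
induced22? R? a b c d =
  ¬? (a ≟ᶠ c) ×-dec ¬? (b ≟ᶠ d) ×-dec R? a c ×-dec R? b d ×-dec
  incomp? R? a b ×-dec incomp? R? a d ×-dec incomp? R? c b ×-dec incomp? R? c d

induced22On? : {N : ℕ} {R : BinRel N} → DecRel R → (X : Subset N) → Dec (Induced22On R X)
induced22On? R? X =
  any? λ a → any? λ b → any? λ c → any? λ d →
  (a ∈? X) ×-dec (b ∈? X) ×-dec (c ∈? X) ×-dec (d ∈? X) ×-dec induced22? R? a b c d

-- list of all subsets of Fin N (each exactly once)
allSubsets : (N : ℕ) → List (Subset N)
allSubsets zero = [] ∷ []
allSubsets (suc N) = map (outside ∷_) (allSubsets N) ++ map (inside ∷_) (allSubsets N)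

count22 : {N : ℕ} {R : BinRel N} → DecRel R → ℕ
count22 {N} R? =
  length (filter (λ X → (∣ X ∣ ≟ 4) ×-dec induced22On? R? X) (allSubsets N))

Conditions : {N : ℕ} → BinRel N → (a b c d : Fin N) → Subset N → Subset N → Set
Conditions {N} R a b c d S₁ S₂ =
  (a ∈ S₁ × b ∈ S₁ × c ∈ S₂ × d ∈ S₂) ×
  (∀ x y → x ∈ S₁ → y ∈ S₁ → x ≢ y → Incomp R x y) ×
  (∀ x y → x ∈ S₂ → y ∈ S₂ → x ≢ y → Incomp R x y) ×
  (∀ (A : Subset N) → A ⊆ S₁ → Nonempty A → (∃ λ z → z ∈ S₁ × z ∉ A) →
     Σ (Fin N) λ x → Σ (Fin N) λ y → Σ (Fin N) λ z → Σ (Fin N) λ t →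
     x ∈ A × y ∈ S₁ × y ∉ A × z ∈ S₂ × t ∈ S₂ × Induced22On4 R x y z t) ×
  (∀ (B : Subset N) → B ⊆ S₂ → Nonempty B → (∃ λ z → z ∈ S₂ × z ∉ B) →
     Σ (Fin N) λ x → Σ (Fin N) λ y → Σ (Fin N) λ z → Σ (Fin N) λ t →
     x ∈ B × y ∈ S₂ × y ∉ B × z ∈ S₁ × t ∈ S₁ × Induced22On4 R x y z t) ×
  (∀ x y → x ∈ S₁ → y ∈ S₂ → R x y ⊎ Incomp R x y)

MaximalPair : {N : ℕ} → BinRel N → (a b c d : Fin N) → Subset N → Subset N → Set
MaximalPair R a b c d S₁ S₂ =
  Conditions R a b c d S₁ S₂ ×
  (∀ T₁ T₂ → Conditions R a b c d T₁ T₂ → S₁ ⊆ T₁ → S₂ ⊆ T₂ → T₁ ≡ S₁ × T₂ ≡ S₂)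

-- v : Fin m → Fin N enumerates S (v i is the element v_{i+1}), bijectively
Enumerates : {N m : ℕ} → Subset N → (Fin m → Fin N) → Set
Enumerates {N} S v = Injective _≡_ _≡_ v × (∀ (x : Fin N) → (x ∈ S ⇔ ∃ λ i → v i ≡ x))

OutsideBoth : {N : ℕ} → Subset N → Subset N → Fin N → Set
OutsideBoth S₁ S₂ x = x ∉ S₁ × x ∉ S₂

-- the relation <_Q.  With 0-based indices i : Fin m, v i = v_{toℕ i + 1},
-- so the paper's condition "i > k" becomes k ≤ toℕ i.
QRel : {N m n : ℕ} → BinRel N → Subset N → Subset N →
       (Fin m → Fin N) → (Fin n → Fin N) → ℕ → BinRel N
QRel {N} {m} {n} R S₁ S₂ v w k x y =
  ((OutsideBoth S₁ S₂ x ⊎ OutsideBoth S₁ S₂ y) × R x y) ⊎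
  (Σ (Fin m) λ i → Σ (Fin n) λ j → v i ≡ x × w j ≡ y × k ≤ toℕ i)

QRel? : {N m n : ℕ} {R : BinRel N} → DecRel R → (S₁ S₂ : Subset N) →
        (v : Fin m → Fin N) → (w : Fin n → Fin N) → (k : ℕ) → DecRel (QRel R S₁ S₂ v w k)
QRel? R? S₁ S₂ v w k x y =
  (((¬? (x ∈? S₁) ×-dec ¬? (x ∈? S₂)) ⊎-dec (¬? (y ∈? S₁) ×-dec ¬? (y ∈? S₂))) ×-dec R? x y)
  ⊎-dec
  (any? λ i → any? λ j → (v i ≟ᶠ x) ×-dec (w j ≟ᶠ y) ×-dec (k ≤? toℕ i))

-- Every induced (2+2) of Q is one of P, while {a, b, c, d} is an induced (2+2) of P but not
-- of Q, because between V₁ and V₂ whether x <Q y holds depends only on x.  Q only adds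
-- relations x < y with x ∈ V₁, y ∈ V₂, so the work is to show that such a new relation never
-- appears in an induced (2+2) of Q.  The maximality of (V₁, V₂) and (3+1)-freeness force every
-- element outside V₁ ∪ V₂ to be comparable to all or to none of V₁ (and of V₂), and forbid
-- outside elements that could be added to V₁ and V₂; these are exactly the configurations
-- such a (2+2) would need.

module Submission where

open import Defs
open import Data.Empty using (⊥; ⊥-elim)
open import Data.Fin using (Fin; zero; suc; toℕ)
open import Data.Fin.Properties using (any?) renaming (_≟_ to _≟ᶠ_)
open import Data.Fin.Subset using (Subset; _∈_; _∉_; _⊆_; Nonempty; ⁅_⁆; _∪_; _∩_; ∣_∣; inside; outside)
open import Data.Fin.Subset.Properties
  using (_∈?_; ⊆-refl; p⊆p∪q; q⊆p∪q; x∈p∪q⁻; x∈p∩q⁺; x∈p∩q⁻; x∈⁅x⁆; x∈⁅y⁆⇒x≡y; x≢y⇒x∉⁅y⁆; ∣⁅x⁆∣≡1; ∪-identityʳ)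
open import Data.List using (_∷_; map; length; filter)
open import Data.List.Relation.Unary.Any using (here; there)
open import Data.List.Membership.Propositional using () renaming (_∈_ to _∈ˡ_)
open import Data.List.Membership.Propositional.Properties using (∈-map⁺; ∈-++⁺ˡ; ∈-++⁺ʳ)
open import Data.List.Relation.Binary.Sublist.Propositional using () renaming (⊆-refl to sublist-refl)
open import Data.List.Relation.Binary.Sublist.Heterogeneous.Properties using (⊆-filter-Sublist; length-mono-≤)
open import Data.Nat using (ℕ; suc; _+_; _≟_; _≤_; _<_; s≤s)
open import Data.Nat.Properties using (m<n⇒m<1+n)
open import Data.Product using (Σ; ∃; ∃₂; _×_; _,_; proj₁; proj₂)
open import Data.Sum using (_⊎_; inj₁; inj₂; [_,_]; map₂; swap)
open import Data.Vec using ([]; _∷_; here; there; tabulate)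
open import Data.Vec.Properties using ([]=⇒lookup; lookup⇒[]=; lookup∘tabulate)
open import Function using (_∘_; Equivalence)
open import Relation.Nullary using (¬_; Dec; yes; no; does; contradiction)
open import Relation.Nullary.Decidable using (dec-true; _×-dec_; _⊎-dec_; ¬?)
open import Level using (0ℓ)
open import Relation.Unary using (Pred; Decidable)
open import Relation.Binary.Structures using (IsStrictPartialOrder)
open import Relation.Binary.PropositionalEquality using (_≡_; _≢_; refl; sym; trans; cong; ≢-sym; module ≡-Reasoning)

allSubsets-complete : ∀ {n} (X : Subset n) → X ∈ˡ allSubsets n
allSubsets-complete [] = here refl
allSubsets-complete {suc n} (outside ∷ X) =
  ∈-++⁺ˡ (∈-map⁺ (outside ∷_) (allSubsets-complete X))
allSubsets-complete {suc n} (inside ∷ X) =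
  ∈-++⁺ʳ (map (outside ∷_) (allSubsets n)) (∈-map⁺ (inside ∷_) (allSubsets-complete X))

module _ {A : Set} {P Q : Pred A 0ℓ} (P? : Decidable P) (Q? : Decidable Q) (Q⇒P : ∀ {x} → Q x → P x) where

  length-filter-mono : ∀ xs → length (filter Q? xs) ≤ length (filter P? xs)
  length-filter-mono xs = length-mono-≤ (⊆-filter-Sublist Q? P? (λ { refl → Q⇒P }) (sublist-refl {x = xs}))

  length-filter-strict : ∀ {y} xs → y ∈ˡ xs → P y → ¬ Q y →
                         length (filter Q? xs) < length (filter P? xs)
  length-filter-strict (x ∷ xs) (here refl) Px ¬Qx with Q? x | P? x
  ... | yes Qx | _     = contradiction Qx ¬Qx
  ... | no _   | yes _ = s≤s (length-filter-mono xs)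
  ... | no _   | no ¬Px = contradiction Px ¬Px
  length-filter-strict (x ∷ xs) (there y∈xs) Py ¬Qy with Q? x | P? x
  ... | yes _  | yes _  = s≤s (length-filter-strict xs y∈xs Py ¬Qy)
  ... | yes Qx | no ¬Px = contradiction (Q⇒P Qx) ¬Px
  ... | no _   | yes _  = m<n⇒m<1+n (length-filter-strict xs y∈xs Py ¬Qy)
  ... | no _   | no _   = length-filter-strict xs y∈xs Py ¬Qy

module _ {n : ℕ} {P : Pred (Fin n) 0ℓ} (P? : Decidable P) where

  subsetOf : Subset n
  subsetOf = tabulate (does ∘ P?)

  ∈subsetOf⁺ : ∀ {x} → P x → x ∈ subsetOf
  ∈subsetOf⁺ {x} Px = lookup⇒[]= x subsetOf (trans (lookup∘tabulate _ x) (dec-true (P? x) Px))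

  ∈subsetOf⁻ : ∀ {x} → x ∈ subsetOf → P x
  ∈subsetOf⁻ {x} x∈ with P? x | trans (sym (lookup∘tabulate _ x)) ([]=⇒lookup x∈)
  ... | yes Px | _  = Px
  ... | no _   | ()

  ∈∩subsetOf⁺ : ∀ {S x} → x ∈ S → P x → x ∈ S ∩ subsetOf
  ∈∩subsetOf⁺ x∈S Px = x∈p∩q⁺ (x∈S , ∈subsetOf⁺ Px)

  ∈∩subsetOf⁻ : ∀ {S x} → x ∈ S ∩ subsetOf → x ∈ S × P x
  ∈∩subsetOf⁻ {S} x∈ = let (x∈S , x∈P) = x∈p∩q⁻ S subsetOf x∈ in x∈S , ∈subsetOf⁻ x∈P

  ∉∩subsetOf⇒¬ : ∀ {S x} → x ∈ S → x ∉ S ∩ subsetOf → ¬ P x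
  ∉∩subsetOf⇒¬ x∈S x∉ = x∉ ∘ ∈∩subsetOf⁺ x∈S

∣p∪⁅x⁆∣≡1+∣p∣ : ∀ {n} {p : Subset n} {x} → x ∉ p → ∣ p ∪ ⁅ x ⁆ ∣ ≡ suc ∣ p ∣
∣p∪⁅x⁆∣≡1+∣p∣ {p = outside ∷ p} {zero}  _   = cong (suc ∘ ∣_∣) (∪-identityʳ p)
∣p∪⁅x⁆∣≡1+∣p∣ {p = inside  ∷ p} {zero}  x∉p = contradiction here x∉p
∣p∪⁅x⁆∣≡1+∣p∣ {p = outside ∷ p} {suc x} x∉p = ∣p∪⁅x⁆∣≡1+∣p∣ (x∉p ∘ there)
∣p∪⁅x⁆∣≡1+∣p∣ {p = inside  ∷ p} {suc x} x∉p = cong suc (∣p∪⁅x⁆∣≡1+∣p∣ (x∉p ∘ there))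

module _ {n : ℕ} where

  ∈-∪⁅⁆⁻ : ∀ {p : Subset n} {x u} → u ∈ p ∪ ⁅ x ⁆ → u ∈ p ⊎ u ≡ x
  ∈-∪⁅⁆⁻ {p} {x} = map₂ (x∈⁅y⁆⇒x≡y x) ∘ x∈p∪q⁻ p ⁅ x ⁆

  x∈p∪⁅x⁆ : ∀ {p : Subset n} x → x ∈ p ∪ ⁅ x ⁆
  x∈p∪⁅x⁆ {p} x = q⊆p∪q p ⁅ x ⁆ (x∈⁅x⁆ x)

  p⊆p∪⁅x⁆ : ∀ {p : Subset n} {x} → p ⊆ p ∪ ⁅ x ⁆
  p⊆p∪⁅x⁆ {p} {x} = p⊆p∪q ⁅ x ⁆

  ∉-∪⁅⁆ : ∀ {p : Subset n} {x u} → u ∉ p → u ≢ x → u ∉ p ∪ ⁅ x ⁆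
  ∉-∪⁅⁆ u∉p u≢x = [ u∉p , u≢x ] ∘ ∈-∪⁅⁆⁻

  ∀-∪⁅⁆ : ∀ {p : Subset n} {x} {P : Fin n → Set} →
          (∀ y → y ∈ p → P y) → P x → ∀ y → y ∈ p ∪ ⁅ x ⁆ → P y
  ∀-∪⁅⁆ Pp Px y y∈ with ∈-∪⁅⁆⁻ y∈
  ... | inj₁ y∈p = Pp y y∈p
  ... | inj₂ refl = Px

  fourSet : Fin n → Fin n → Fin n → Fin n → Subset n
  fourSet x y z t = ((⁅ x ⁆ ∪ ⁅ y ⁆) ∪ ⁅ z ⁆) ∪ ⁅ t ⁆

  pattern #1 = inj₁ refl
  pattern #2 = inj₂ (inj₁ refl)
  pattern #3 = inj₂ (inj₂ (inj₁ refl))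
  pattern #4 = inj₂ (inj₂ (inj₂ refl))

  ∈fourSet⁺ : ∀ {u x y z t} → OneOf4 u x y z t → u ∈ fourSet x y z t
  ∈fourSet⁺ {x = x} #1 = p⊆p∪⁅x⁆ (p⊆p∪⁅x⁆ (p⊆p∪⁅x⁆ (x∈⁅x⁆ x)))
  ∈fourSet⁺         #2 = p⊆p∪⁅x⁆ (p⊆p∪⁅x⁆ (x∈p∪⁅x⁆ _))
  ∈fourSet⁺         #3 = p⊆p∪⁅x⁆ (x∈p∪⁅x⁆ _)
  ∈fourSet⁺         #4 = x∈p∪⁅x⁆ _

  ∈fourSet⁻ : ∀ {u x y z t} → u ∈ fourSet x y z t → OneOf4 u x y z t
  ∈fourSet⁻ {x = x} u∈ with ∈-∪⁅⁆⁻ u∈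
  ... | inj₂ refl = #4
  ... | inj₁ u∈xyz with ∈-∪⁅⁆⁻ u∈xyz
  ...   | inj₂ refl = #3
  ...   | inj₁ u∈xy with ∈-∪⁅⁆⁻ u∈xy
  ...     | inj₂ refl = #2
  ...     | inj₁ u∈x rewrite x∈⁅y⁆⇒x≡y x u∈x = #1

  ∣fourSet∣≡4 : ∀ {x y z t} → x ≢ y → x ≢ z → x ≢ t → y ≢ z → y ≢ t → z ≢ t →
                ∣ fourSet x y z t ∣ ≡ 4
  ∣fourSet∣≡4 {x} {y} {z} {t} x≢y x≢z x≢t y≢z y≢t z≢t = begin
    ∣ ((⁅ x ⁆ ∪ ⁅ y ⁆) ∪ ⁅ z ⁆) ∪ ⁅ t ⁆ ∣
      ≡⟨ ∣p∪⁅x⁆∣≡1+∣p∣ (∉-∪⁅⁆ (∉-∪⁅⁆ (x≢y⇒x∉⁅y⁆ (≢-sym x≢t)) (≢-sym y≢t)) (≢-sym z≢t)) ⟩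
    suc ∣ (⁅ x ⁆ ∪ ⁅ y ⁆) ∪ ⁅ z ⁆ ∣
      ≡⟨ cong suc (∣p∪⁅x⁆∣≡1+∣p∣ (∉-∪⁅⁆ (x≢y⇒x∉⁅y⁆ (≢-sym x≢z)) (≢-sym y≢z))) ⟩
    suc (suc ∣ ⁅ x ⁆ ∪ ⁅ y ⁆ ∣)
      ≡⟨ cong (2 +_) (∣p∪⁅x⁆∣≡1+∣p∣ (x≢y⇒x∉⁅y⁆ (≢-sym x≢y))) ⟩
    suc (suc (suc ∣ ⁅ x ⁆ ∣))
      ≡⟨ cong (3 +_) (∣⁅x⁆∣≡1 x) ⟩
    4 ∎
    where open ≡-Reasoning

OneOf4-swap₁₂ : ∀ {n} {u x y z t : Fin n} → OneOf4 u x y z t → OneOf4 u y x z t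
OneOf4-swap₁₂ #1 = #2
OneOf4-swap₁₂ #2 = #1
OneOf4-swap₁₂ #3 = #3
OneOf4-swap₁₂ #4 = #4

OneOf4-swapPairs : ∀ {n} {u x y z t : Fin n} → OneOf4 u x y z t → OneOf4 u z t x y
OneOf4-swapPairs #1 = #3
OneOf4-swapPairs #2 = #4
OneOf4-swapPairs #3 = #1
OneOf4-swapPairs #4 = #2

module Incomparability {N : ℕ} (R : BinRel N) where

  Incomp-sym : ∀ {x y} → Incomp R x y → Incomp R y x
  Incomp-sym (x≢y , ¬xRy , ¬yRx) = ≢-sym x≢y , ¬yRx , ¬xRy

  Incomp⇒≢ : ∀ {x y} → Incomp R x y → x ≢ y
  Incomp⇒≢ = proj₁

  Incomp⇒¬R : ∀ {x y} → Incomp R x y → ¬ R x y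
  Incomp⇒¬R = proj₁ ∘ proj₂

  Incomp⇒¬R˘ : ∀ {x y} → Incomp R x y → ¬ R y x
  Incomp⇒¬R˘ = proj₂ ∘ proj₂

  IsInduced22-swap : ∀ {x y z t} → IsInduced22 R x y z t → IsInduced22 R y x t z
  IsInduced22-swap (x≢z , y≢t , xRz , yRt , x∥y , x∥t , z∥y , z∥t) =
    y≢t , x≢z , yRt , xRz , Incomp-sym x∥y , Incomp-sym z∥y , Incomp-sym x∥t , Incomp-sym z∥t

  induced22On4 : ∀ {p q r s x y z t} → IsInduced22 R p q r s →
    OneOf4 p x y z t → OneOf4 q x y z t → OneOf4 r x y z t → OneOf4 s x y z t →
    Induced22On4 R x y z t
  induced22On4 {p} {q} {r} {s} h p∈ q∈ r∈ s∈ = p , q , r , s , p∈ , q∈ , r∈ , s∈ , h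

  Induced22On4-reorder : ∀ {x y z t x' y' z' t'} → Induced22On4 R x y z t →
    (∀ {u} → OneOf4 u x y z t → OneOf4 u x' y' z' t') → Induced22On4 R x' y' z' t'
  Induced22On4-reorder (p , q , r , s , p∈ , q∈ , r∈ , s∈ , h) f = induced22On4 h (f p∈) (f q∈) (f r∈) (f s∈)

  IsInduced22⇒Induced22On : ∀ {x y z t} → IsInduced22 R x y z t → Induced22On R (fourSet x y z t)
  IsInduced22⇒Induced22On {x} {y} {z} {t} h =
    x , y , z , t , ∈fourSet⁺ #1 , ∈fourSet⁺ #2 , ∈fourSet⁺ #3 , ∈fourSet⁺ #4 , h

  IsInduced22⇒∣fourSet∣≡4 : ∀ {x y z t} → IsInduced22 R x y z t → ∣ fourSet x y z t ∣ ≡ 4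
  IsInduced22⇒∣fourSet∣≡4 (x≢z , y≢t , _ , _ , (x≢y , _) , (x≢t , _) , (z≢y , _) , (z≢t , _)) =
    ∣fourSet∣≡4 x≢y x≢z x≢t (≢-sym z≢y) y≢t z≢t

count22-< : ∀ {N} {R S : BinRel N} (R? : DecRel R) (S? : DecRel S) →
  (∀ {x y z t} → IsInduced22 S x y z t → IsInduced22 R x y z t) →
  ∀ {X} → ∣ X ∣ ≡ 4 → Induced22On R X → ¬ Induced22On S X → count22 S? < count22 R?
count22-< {N} R? S? S⇒R {X} ∣X∣≡4 R-on-X ¬S-on-X =
  length-filter-strict (λ Y → (∣ Y ∣ ≟ 4) ×-dec induced22On? R? Y) (λ Y → (∣ Y ∣ ≟ 4) ×-dec induced22On? S? Y)
    (λ { (∣Y∣≡4 , x , y , z , t , x∈ , y∈ , z∈ , t∈ , h) → ∣Y∣≡4 , x , y , z , t , x∈ , y∈ , z∈ , t∈ , S⇒R h })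
    (allSubsets N) (allSubsets-complete X) (∣X∣≡4 , R-on-X) (¬S-on-X ∘ proj₂)

module _ {N : ℕ} (R : BinRel N) where

  Antichain : Subset N → Set
  Antichain S = ∀ x y → x ∈ S → y ∈ S → x ≢ y → Incomp R x y

  WeaklyBelow : Subset N → Subset N → Set
  WeaklyBelow S T = ∀ x y → x ∈ S → y ∈ T → R x y ⊎ Incomp R x y

  SplitBy22 : Subset N → Subset N → Set
  SplitBy22 S T = ∀ (A : Subset N) → A ⊆ S → Nonempty A → (∃ λ z → z ∈ S × z ∉ A) →
     Σ (Fin N) λ x → Σ (Fin N) λ y → Σ (Fin N) λ z → Σ (Fin N) λ t →
     x ∈ A × y ∈ S × y ∉ A × z ∈ T × t ∈ T × Induced22On4 R x y z t

  Anchor : Fin N → Subset N → Subset N → Set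
  Anchor z S T = Σ (Fin N) λ s → Σ (Fin N) λ u → Σ (Fin N) λ u' →
    s ∈ S × u ∈ T × u' ∈ T × Induced22On4 R z s u u'

  Anchored : Subset N → Subset N → Subset N → Set
  Anchored S T S' = ∀ z → z ∈ S' → z ∉ S → Anchor z S T

module _ {N : ℕ} {R : BinRel N} where

  open Incomparability R

  -- If A meets S without containing it, the old split of A ∩ S works; otherwise
  -- some new element (inside A, resp. outside A) is anchored to an old element
  -- of S on the other side of A.
  SplitBy22-extend : ∀ {S T S' T'} → S ⊆ S' → T ⊆ T' →
    SplitBy22 R S T → Anchored R S T' S' → SplitBy22 R S' T'
  SplitBy22-extend {S} S⊆S' T⊆T' split anchored A A⊆S' (x , x∈A) (u , u∈S' , u∉A)
    with any? (λ y → (y ∈? A) ×-dec (y ∈? S)) | any? (λ y → (y ∈? S) ×-dec ¬? (y ∈? A))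
  ... | yes (y , y∈A , y∈S) | yes (y' , y'∈S , y'∉A)
    with split (A ∩ S) (proj₂ ∘ x∈p∩q⁻ A S) (y , x∈p∩q⁺ (y∈A , y∈S)) (y' , y'∈S , y'∉A ∘ proj₁ ∘ x∈p∩q⁻ A S)
  ...   | p , q , r , r' , p∈A∩S , q∈S , q∉A∩S , r∈T , r'∈T , h =
    p , q , r , r' , proj₁ (x∈p∩q⁻ A S p∈A∩S) , S⊆S' q∈S , (λ q∈A → q∉A∩S (x∈p∩q⁺ (q∈A , q∈S))) ,
    T⊆T' r∈T , T⊆T' r'∈T , h
  SplitBy22-extend S⊆S' T⊆T' split anchored A A⊆S' (x , x∈A) (u , u∈S' , u∉A) | no A∩S-empty | _
    with anchored x (A⊆S' x∈A) (λ x∈S → A∩S-empty (x , x∈A , x∈S))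
  ... | s , r , r' , s∈S , r∈T' , r'∈T' , h =
    x , s , r , r' , x∈A , S⊆S' s∈S , (λ s∈A → A∩S-empty (s , s∈A , s∈S)) , r∈T' , r'∈T' , h
  SplitBy22-extend S⊆S' T⊆T' split anchored A A⊆S' (x , x∈A) (u , u∈S' , u∉A) | yes _ | no S⊆A
    with anchored u u∈S' (λ u∈S → S⊆A (u , u∈S , u∉A))
  ... | s , r , r' , s∈S , r∈T' , r'∈T' , h with s ∈? A
  ...   | no s∉A  = ⊥-elim (S⊆A (s , s∈S , s∉A))
  ...   | yes s∈A = s , u , r , r' , s∈A , u∈S' , u∉A , r∈T' , r'∈T' , Induced22On4-reorder h OneOf4-swap₁₂

  Anchored-refl : ∀ {S T} → Anchored R S T S
  Anchored-refl z z∈S z∉S = ⊥-elim (z∉S z∈S)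

  Anchored-∪⁅⁆ : ∀ {S T z} → Anchor R z S T → Anchored R S T (S ∪ ⁅ z ⁆)
  Anchored-∪⁅⁆ anchor z' z'∈ z'∉S with ∈-∪⁅⁆⁻ z'∈
  ... | inj₁ z'∈S = ⊥-elim (z'∉S z'∈S)
  ... | inj₂ refl = anchor

  Antichain-∪⁅⁆ : ∀ {S o} → Antichain R S → (∀ s → s ∈ S → Incomp R o s) → Antichain R (S ∪ ⁅ o ⁆)
  Antichain-∪⁅⁆ anti o∥S x y x∈ y∈ x≢y with ∈-∪⁅⁆⁻ x∈ | ∈-∪⁅⁆⁻ y∈
  ... | inj₁ x∈S  | inj₁ y∈S  = anti x y x∈S y∈S x≢y
  ... | inj₁ x∈S  | inj₂ refl = Incomp-sym (o∥S x x∈S)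
  ... | inj₂ refl | inj₁ y∈S  = o∥S y y∈S
  ... | inj₂ refl | inj₂ refl = ⊥-elim (x≢y refl)

  WeaklyBelow-∪⁅⁆ʳ : ∀ {S T o} → WeaklyBelow R S T → (∀ x → x ∈ S → R x o ⊎ Incomp R x o) →
    WeaklyBelow R S (T ∪ ⁅ o ⁆)
  WeaklyBelow-∪⁅⁆ʳ below below-o x y x∈S = ∀-∪⁅⁆ (λ y' → below x y' x∈S) (below-o x x∈S) y

  WeaklyBelow-∪⁅⁆ˡ : ∀ {S T o} → WeaklyBelow R S T → (∀ y → y ∈ T → R o y ⊎ Incomp R o y) →
    WeaklyBelow R (S ∪ ⁅ o ⁆) T
  WeaklyBelow-∪⁅⁆ˡ below o-below x y x∈ y∈T =
    ∀-∪⁅⁆ (λ x' x'∈S → below x' y x'∈S y∈T) (o-below y y∈T) x x∈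

module StrictOrder {N : ℕ} {_≺_ : BinRel N} (spo : IsStrictPartialOrder _≡_ _≺_) (_≺?_ : DecRel _≺_) where

  open IsStrictPartialOrder spo public using () renaming (trans to ≺-trans; asym to ≺-asym)
  open Incomparability _≺_ public
    renaming (Incomp-sym to ∥-sym; Incomp⇒≢ to ∥⇒≢; Incomp⇒¬R to ∥⇒⊀; Incomp⇒¬R˘ to ∥⇒⊁)

  infix 4 _∥_
  _∥_ : Fin N → Fin N → Set
  _∥_ = Incomp _≺_

  Comparable : Fin N → Fin N → Set
  Comparable x y = x ≺ y ⊎ y ≺ x

  comparable? : ∀ x y → Dec (Comparable x y)
  comparable? x y = (x ≺? y) ⊎-dec (y ≺? x)

  ≺-irrefl : ∀ {x} → ¬ x ≺ x
  ≺-irrefl = IsStrictPartialOrder.irrefl spo refl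

  ≺⇒≢ : ∀ {x y} → x ≺ y → x ≢ y
  ≺⇒≢ x≺x refl = ≺-irrefl x≺x

  ∥⇒¬comparable : ∀ {x y} → x ∥ y → ¬ Comparable x y
  ∥⇒¬comparable x∥y = [ ∥⇒⊀ x∥y , ∥⇒⊁ x∥y ]

  ¬comparable⇒∥ : ∀ {x y} → x ≢ y → ¬ Comparable x y → x ∥ y
  ¬comparable⇒∥ x≢y x≁y = x≢y , x≁y ∘ inj₁ , x≁y ∘ inj₂

  Antichain⇒⊀ : ∀ {S x y} → Antichain _≺_ S → x ∈ S → y ∈ S → ¬ x ≺ y
  Antichain⇒⊀ {x = x} {y} anti x∈ y∈ x≺y = ∥⇒⊀ (anti x y x∈ y∈ (≺⇒≢ x≺y)) x≺y

  module _ {Low High : Pred (Fin N) 0ℓ}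
    (Low-⊀ : ∀ {u u'} → Low u → Low u' → ¬ u ≺ u')
    (High-⊀ : ∀ {u u'} → High u → High u' → ¬ u ≺ u')
    (High-⊀-Low : ∀ {u u'} → High u → Low u' → ¬ u ≺ u') where

    private
      position : ∀ {u x y z t} → Low x → Low y → High z → High t → OneOf4 u x y z t →
        (Low u × (u ≡ x ⊎ u ≡ y)) ⊎ (High u × (u ≡ z ⊎ u ≡ t))
      position Lx _  _  _  #1 = inj₁ (Lx , inj₁ refl)
      position _  Ly _  _  #2 = inj₁ (Ly , inj₂ refl)
      position _  _  Hz _  #3 = inj₂ (Hz , inj₁ refl)
      position _  _  _  Ht #4 = inj₂ (Ht , inj₂ refl)

      ≺-goes-up : ∀ {u u' x y z t} → Low x → Low y → High z → High t →
        OneOf4 u x y z t → OneOf4 u' x y z t → u ≺ u' → (u ≡ x ⊎ u ≡ y) × (u' ≡ z ⊎ u' ≡ t)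
      ≺-goes-up Lx Ly Hz Ht u∈ u'∈ u≺u' with position Lx Ly Hz Ht u∈ | position Lx Ly Hz Ht u'∈
      ... | inj₁ (_ , u∈xy)  | inj₂ (_ , u'∈zt) = u∈xy , u'∈zt
      ... | inj₁ (Lu , _)    | inj₁ (Lu' , _)   = ⊥-elim (Low-⊀ Lu Lu' u≺u')
      ... | inj₂ (Hu , _)    | inj₁ (Lu' , _)   = ⊥-elim (High-⊀-Low Hu Lu' u≺u')
      ... | inj₂ (Hu , _)    | inj₂ (Hu' , _)   = ⊥-elim (High-⊀ Hu Hu' u≺u')

    induced22-bipartite : ∀ {x y z t} → Low x → Low y → High z → High t → Induced22On4 _≺_ x y z t →
      IsInduced22 _≺_ x y z t ⊎ IsInduced22 _≺_ x y t z
    induced22-bipartite Lx Ly Hz Ht (p , q , r , s , p∈ , q∈ , r∈ , s∈ , h@(_ , _ , p≺r , q≺s , (p≢q , _) , _ , _ , (r≢s , _)))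
      with ≺-goes-up Lx Ly Hz Ht p∈ r∈ p≺r | ≺-goes-up Lx Ly Hz Ht q∈ s∈ q≺s
    ... | inj₁ refl , inj₁ refl | inj₂ refl , inj₂ refl = inj₁ h
    ... | inj₁ refl , inj₂ refl | inj₂ refl , inj₁ refl = inj₂ h
    ... | inj₂ refl , inj₁ refl | inj₁ refl , inj₂ refl = inj₂ (IsInduced22-swap h)
    ... | inj₂ refl , inj₂ refl | inj₁ refl , inj₁ refl = inj₁ (IsInduced22-swap h)
    ... | inj₁ refl , _ | inj₁ refl , _ = ⊥-elim (p≢q refl)
    ... | inj₂ refl , _ | inj₂ refl , _ = ⊥-elim (p≢q refl)
    ... | inj₁ refl , inj₁ refl | inj₂ refl , inj₁ refl = ⊥-elim (r≢s refl)
    ... | inj₁ refl , inj₂ refl | inj₂ refl , inj₂ refl = ⊥-elim (r≢s refl)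
    ... | inj₂ refl , inj₁ refl | inj₁ refl , inj₁ refl = ⊥-elim (r≢s refl)
    ... | inj₂ refl , inj₂ refl | inj₁ refl , inj₂ refl = ⊥-elim (r≢s refl)

module MaximalPairProperties
  {N : ℕ} {_≺_ : BinRel N} (spo : IsStrictPartialOrder _≡_ _≺_) (_≺?_ : DecRel _≺_)
  (3+1-free : ThreeOneFree _≺_)
  {a b c d : Fin N} (abcd : IsInduced22 _≺_ a b c d)
  {V₁ V₂ : Subset N}
  (a∈V₁ : a ∈ V₁) (b∈V₁ : b ∈ V₁) (c∈V₂ : c ∈ V₂) (d∈V₂ : d ∈ V₂)
  (V₁-antichain : Antichain _≺_ V₁) (V₂-antichain : Antichain _≺_ V₂)
  (V₁-split : SplitBy22 _≺_ V₁ V₂) (V₂-split : SplitBy22 _≺_ V₂ V₁)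
  (V₁-below-V₂ : WeaklyBelow _≺_ V₁ V₂)
  (maximality : ∀ T₁ T₂ → Conditions _≺_ a b c d T₁ T₂ → V₁ ⊆ T₁ → V₂ ⊆ T₂ → T₁ ≡ V₁ × T₂ ≡ V₂)
  where

  open StrictOrder spo _≺?_

  Outside : Fin N → Set
  Outside = OutsideBoth V₁ V₂

  data Block (x : Fin N) : Set where
    in-V₁ : x ∈ V₁ → Block x
    in-V₂ : x ∈ V₂ → Block x
    out   : Outside x → Block x

  block : ∀ x → Block x
  block x with x ∈? V₁ | x ∈? V₂
  ... | yes x∈V₁ | _        = in-V₁ x∈V₁
  ... | no _     | yes x∈V₂ = in-V₂ x∈V₂
  ... | no x∉V₁  | no x∉V₂  = out (x∉V₁ , x∉V₂)

  V₁∩V₂-empty : ∀ {x} → x ∈ V₁ → x ∈ V₂ → ⊥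
  V₁∩V₂-empty {x} x∈V₁ x∈V₂ with V₁-below-V₂ x x x∈V₁ x∈V₂
  ... | inj₁ x≺x = ≺-irrefl x≺x
  ... | inj₂ x∥x = ∥⇒≢ x∥x refl

  V₂⊀V₁ : ∀ {x y} → x ∈ V₁ → y ∈ V₂ → ¬ y ≺ x
  V₂⊀V₁ {x} {y} x∈V₁ y∈V₂ y≺x with V₁-below-V₂ x y x∈V₁ y∈V₂
  ... | inj₁ x≺y = ≺-asym x≺y y≺x
  ... | inj₂ x∥y = ∥⇒⊁ x∥y y≺x

  V₁-⊀ : ∀ {x y} → x ∈ V₁ → y ∈ V₁ → ¬ x ≺ y
  V₁-⊀ = Antichain⇒⊀ V₁-antichain

  V₂-⊀ : ∀ {x y} → x ∈ V₂ → y ∈ V₂ → ¬ x ≺ y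
  V₂-⊀ = Antichain⇒⊀ V₂-antichain

  Outside⇒≢₁ : ∀ {o x} → Outside o → x ∈ V₁ → o ≢ x
  Outside⇒≢₁ (o∉V₁ , _) x∈V₁ refl = o∉V₁ x∈V₁

  Outside⇒≢₂ : ∀ {o x} → Outside o → x ∈ V₂ → o ≢ x
  Outside⇒≢₂ (_ , o∉V₂) x∈V₂ refl = o∉V₂ x∈V₂

  induced22-across : ∀ {x y z t} → x ∈ V₁ → y ∈ V₁ → z ∈ V₂ → t ∈ V₂ → Induced22On4 _≺_ x y z t →
    IsInduced22 _≺_ x y z t ⊎ IsInduced22 _≺_ x y t z
  induced22-across = induced22-bipartite V₁-⊀ V₂-⊀ (λ z∈V₂ x∈V₁ → V₂⊀V₁ x∈V₁ z∈V₂)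

  V₁-separated : ∀ {P : Pred (Fin N) 0ℓ} → Decidable P → ∀ {s s'} → s ∈ V₁ → P s → s' ∈ V₁ → ¬ P s' →
    Σ (Fin N) λ x → Σ (Fin N) λ y → Σ (Fin N) λ z → Σ (Fin N) λ t →
    x ∈ V₁ × P x × y ∈ V₁ × ¬ P y × z ∈ V₂ × t ∈ V₂ × IsInduced22 _≺_ x y z t
  V₁-separated P? {s} {s'} s∈V₁ Ps s'∈V₁ ¬Ps'
    with V₁-split (V₁ ∩ subsetOf P?) (proj₁ ∘ ∈∩subsetOf⁻ P?) (s , ∈∩subsetOf⁺ P? s∈V₁ Ps)
                  (s' , s'∈V₁ , ¬Ps' ∘ proj₂ ∘ ∈∩subsetOf⁻ P?)
  ... | x , y , z , t , x∈A , y∈V₁ , y∉A , z∈V₂ , t∈V₂ , h with ∈∩subsetOf⁻ P? x∈A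
  ...   | x∈V₁ , Px with induced22-across x∈V₁ y∈V₁ z∈V₂ t∈V₂ h
  ...     | inj₁ h' = x , y , z , t , x∈V₁ , Px , y∈V₁ , ∉∩subsetOf⇒¬ P? y∈V₁ y∉A , z∈V₂ , t∈V₂ , h'
  ...     | inj₂ h' = x , y , t , z , x∈V₁ , Px , y∈V₁ , ∉∩subsetOf⇒¬ P? y∈V₁ y∉A , t∈V₂ , z∈V₂ , h'

  V₂-separated : ∀ {P : Pred (Fin N) 0ℓ} → Decidable P → ∀ {s s'} → s ∈ V₂ → P s → s' ∈ V₂ → ¬ P s' →
    Σ (Fin N) λ x → Σ (Fin N) λ y → Σ (Fin N) λ z → Σ (Fin N) λ t →
    x ∈ V₂ × P x × y ∈ V₂ × ¬ P y × z ∈ V₁ × t ∈ V₁ × IsInduced22 _≺_ z t x y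
  V₂-separated P? {s} {s'} s∈V₂ Ps s'∈V₂ ¬Ps'
    with V₂-split (V₂ ∩ subsetOf P?) (proj₁ ∘ ∈∩subsetOf⁻ P?) (s , ∈∩subsetOf⁺ P? s∈V₂ Ps)
                  (s' , s'∈V₂ , ¬Ps' ∘ proj₂ ∘ ∈∩subsetOf⁻ P?)
  ... | x , y , z , t , x∈A , y∈V₂ , y∉A , z∈V₁ , t∈V₁ , h with ∈∩subsetOf⁻ P? x∈A
  ...   | x∈V₂ , Px with induced22-across z∈V₁ t∈V₁ x∈V₂ y∈V₂ (Induced22On4-reorder h OneOf4-swapPairs)
  ...     | inj₁ h' = x , y , z , t , x∈V₂ , Px , y∈V₂ , ∉∩subsetOf⇒¬ P? y∈V₂ y∉A , z∈V₁ , t∈V₁ , h'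
  ...     | inj₂ h' = x , y , t , z , x∈V₂ , Px , y∈V₂ , ∉∩subsetOf⇒¬ P? y∈V₂ y∉A , t∈V₁ , z∈V₁ , IsInduced22-swap h'

  private
    a∥b : a ∥ b
    a∥b = let (_ , _ , _ , _ , a∥b , _) = abcd in a∥b

    c∥d : c ∥ d
    c∥d = let (_ , _ , _ , _ , _ , _ , _ , c∥d) = abcd in c∥d

  another-in-V₁ : ∀ u → ∃ λ s → s ∈ V₁ × s ≢ u
  another-in-V₁ u with u ≟ᶠ a
  ... | yes refl = b , b∈V₁ , ≢-sym (∥⇒≢ a∥b)
  ... | no u≢a   = a , a∈V₁ , ≢-sym u≢a

  another-in-V₂ : ∀ u → ∃ λ s → s ∈ V₂ × s ≢ u
  another-in-V₂ u with u ≟ᶠ c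
  ... | yes refl = d , d∈V₂ , ≢-sym (∥⇒≢ c∥d)
  ... | no u≢c   = c , c∈V₂ , ≢-sym u≢c

  below-some-V₂ : ∀ {u} → u ∈ V₁ → ∃ λ s → s ∈ V₂ × u ≺ s
  below-some-V₂ {u} u∈V₁ with another-in-V₁ u
  ... | s , s∈V₁ , s≢u with V₁-separated (_≟ᶠ u) u∈V₁ refl s∈V₁ s≢u
  ... | _ , _ , z , _ , _ , refl , _ , _ , z∈V₂ , _ , (_ , _ , u≺z , _) = z , z∈V₂ , u≺z

  above-some-V₁ : ∀ {u} → u ∈ V₂ → ∃ λ s → s ∈ V₁ × s ≺ u
  above-some-V₁ {u} u∈V₂ with another-in-V₂ u
  ... | s , s∈V₂ , s≢u with V₂-separated (_≟ᶠ u) u∈V₂ refl s∈V₂ s≢u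
  ... | _ , _ , z , _ , _ , refl , _ , _ , z∈V₁ , _ , (_ , _ , z≺u , _) = z , z∈V₁ , z≺u

  extension-impossible : ∀ {T₁ T₂ o} → V₁ ⊆ T₁ → V₂ ⊆ T₂ →
    Antichain _≺_ T₁ → Antichain _≺_ T₂ → Anchored _≺_ V₁ T₂ T₁ → Anchored _≺_ V₂ T₁ T₂ →
    WeaklyBelow _≺_ T₁ T₂ → Outside o → o ∈ T₁ ⊎ o ∈ T₂ → ⊥
  extension-impossible {T₁} {T₂} V₁⊆T₁ V₂⊆T₂ T₁-antichain T₂-antichain T₁-anchored T₂-anchored
                       T₁-below-T₂ (o∉V₁ , o∉V₂) o∈T
    with maximality T₁ T₂
           ( (V₁⊆T₁ a∈V₁ , V₁⊆T₁ b∈V₁ , V₂⊆T₂ c∈V₂ , V₂⊆T₂ d∈V₂)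
           , T₁-antichain , T₂-antichain
           , SplitBy22-extend V₁⊆T₁ V₂⊆T₂ V₁-split T₁-anchored
           , SplitBy22-extend V₂⊆T₂ V₁⊆T₁ V₂-split T₂-anchored
           , T₁-below-T₂ )
           V₁⊆T₁ V₂⊆T₂
  ... | refl , refl = [ o∉V₁ , o∉V₂ ] o∈T

  cannot-join-V₁ : ∀ {o} → Outside o → (∀ s → s ∈ V₁ → o ∥ s) → Anchor _≺_ o V₁ V₂ →
    (∀ y → y ∈ V₂ → o ≺ y ⊎ o ∥ y) → ⊥
  cannot-join-V₁ o-out o∥V₁ anchor o-below-V₂ =
    extension-impossible p⊆p∪⁅x⁆ ⊆-refl (Antichain-∪⁅⁆ V₁-antichain o∥V₁) V₂-antichain
      (Anchored-∪⁅⁆ anchor) Anchored-refl (WeaklyBelow-∪⁅⁆ˡ V₁-below-V₂ o-below-V₂)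
      o-out (inj₁ (x∈p∪⁅x⁆ _))

  cannot-join-V₂ : ∀ {o} → Outside o → (∀ s → s ∈ V₂ → o ∥ s) → Anchor _≺_ o V₂ V₁ →
    (∀ x → x ∈ V₁ → x ≺ o ⊎ x ∥ o) → ⊥
  cannot-join-V₂ o-out o∥V₂ anchor V₁-below-o =
    extension-impossible ⊆-refl p⊆p∪⁅x⁆ V₁-antichain (Antichain-∪⁅⁆ V₂-antichain o∥V₂)
      Anchored-refl (Anchored-∪⁅⁆ anchor) (WeaklyBelow-∪⁅⁆ʳ V₁-below-V₂ V₁-below-o)
      o-out (inj₂ (x∈p∪⁅x⁆ _))

  cannot-join-both : ∀ {o₁ o₂} → Outside o₁ → (∀ s → s ∈ V₁ → o₁ ∥ s) → (∀ s → s ∈ V₂ → o₂ ∥ s) →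
    Anchor _≺_ o₁ V₁ (V₂ ∪ ⁅ o₂ ⁆) → Anchor _≺_ o₂ V₂ (V₁ ∪ ⁅ o₁ ⁆) →
    (∀ x → x ∈ V₁ → x ≺ o₂ ⊎ x ∥ o₂) → (∀ y → y ∈ V₂ → o₁ ≺ y ⊎ o₁ ∥ y) → o₁ ≺ o₂ ⊎ o₁ ∥ o₂ → ⊥
  cannot-join-both o₁-out o₁∥V₁ o₂∥V₂ anchor₁ anchor₂ V₁-below-o₂ o₁-below-V₂ o₁-below-o₂ =
    extension-impossible p⊆p∪⁅x⁆ p⊆p∪⁅x⁆ (Antichain-∪⁅⁆ V₁-antichain o₁∥V₁) (Antichain-∪⁅⁆ V₂-antichain o₂∥V₂)
      (Anchored-∪⁅⁆ anchor₁) (Anchored-∪⁅⁆ anchor₂)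
      (WeaklyBelow-∪⁅⁆ˡ (WeaklyBelow-∪⁅⁆ʳ V₁-below-V₂ V₁-below-o₂) (∀-∪⁅⁆ o₁-below-V₂ o₁-below-o₂))
      o₁-out (inj₁ (x∈p∪⁅x⁆ _))

  -- o ≺ p would give the (3+1) o ≺ p ≺ w₁ beside q; p ≺ o lets o join V₂.
  no-outside-separates-22₁ : ∀ {p q w₁ w₂ o} → p ∈ V₁ → q ∈ V₁ → w₁ ∈ V₂ → w₂ ∈ V₂ →
    IsInduced22 _≺_ p q w₁ w₂ → Outside o → Comparable o p → ¬ Comparable o q → ⊥
  no-outside-separates-22₁ {p} {q} {w₁} {w₂} {o} p∈V₁ q∈V₁ w₁∈V₂ w₂∈V₂
                           (_ , q≢w₂ , p≺w₁ , q≺w₂ , p∥q , p∥w₂ , w₁∥q , _) o-out o~p o≁q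
    with o~p
  ... | inj₁ o≺p = 3+1-free (o , p , w₁ , q , o≺p , p≺w₁ , o∥q , p∥q , w₁∥q)
    where o∥q = ¬comparable⇒∥ (Outside⇒≢₁ o-out q∈V₁) o≁q
  ... | inj₂ p≺o = cannot-join-V₂ o-out o∥V₂ (w₂ , p , q , w₂∈V₂ , p∈V₁ , q∈V₁ , induced22On4 pqow₂ #3 #4 #1 #2) V₁-below-o
    where
    o∥q : o ∥ q
    o∥q = ¬comparable⇒∥ (Outside⇒≢₁ o-out q∈V₁) o≁q

    o∥w₂ : o ∥ w₂
    o∥w₂ = Outside⇒≢₂ o-out w₂∈V₂ , (λ o≺w₂ → ∥⇒⊀ p∥w₂ (≺-trans p≺o o≺w₂)) , (λ w₂≺o → ∥⇒⊁ o∥q (≺-trans q≺w₂ w₂≺o))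

    pqow₂ : IsInduced22 _≺_ p q o w₂
    pqow₂ = ≺⇒≢ p≺o , q≢w₂ , p≺o , q≺w₂ , p∥q , p∥w₂ , o∥q , o∥w₂

    o⊀V₂ : ∀ {s} → s ∈ V₂ → ¬ o ≺ s
    o⊀V₂ {s} s∈V₂ o≺s with s ≟ᶠ w₂
    ... | yes refl = ∥⇒⊀ o∥w₂ o≺s
    ... | no s≢w₂  = 3+1-free (p , o , s , w₂ , p≺o , o≺s , p∥w₂ , o∥w₂ , V₂-antichain s w₂ s∈V₂ w₂∈V₂ s≢w₂)

    V₂⊀o : ∀ {s} → s ∈ V₂ → ¬ s ≺ o
    V₂⊀o {s} s∈V₂ s≺o with above-some-V₁ s∈V₂ | V₁-below-V₂ q s q∈V₁ s∈V₂
    ... | _ , _ , _           | inj₁ q≺s = ∥⇒⊁ o∥q (≺-trans q≺s s≺o)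
    ... | r , r∈V₁ , r≺s | inj₂ q∥s with r ≟ᶠ q
    ...   | yes refl = ∥⇒⊀ q∥s r≺s
    ...   | no r≢q   = 3+1-free (r , s , o , q , r≺s , s≺o , V₁-antichain r q r∈V₁ q∈V₁ r≢q , ∥-sym q∥s , o∥q)

    o∥V₂ : ∀ s → s ∈ V₂ → o ∥ s
    o∥V₂ s s∈V₂ = Outside⇒≢₂ o-out s∈V₂ , o⊀V₂ s∈V₂ , V₂⊀o s∈V₂

    V₁-below-o : ∀ x → x ∈ V₁ → x ≺ o ⊎ x ∥ o
    V₁-below-o x x∈V₁ with x ≺? o
    ... | yes x≺o = inj₁ x≺o
    ... | no x⊀o  = inj₂ (≢-sym (Outside⇒≢₁ o-out x∈V₁) , x⊀o , λ o≺x → V₁-⊀ p∈V₁ x∈V₁ (≺-trans p≺o o≺x))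

  -- p ≺ o would give the (3+1) s₁ ≺ p ≺ o beside q; o ≺ p lets o join V₁.
  no-outside-separates-22₂ : ∀ {p q s₁ s₂ o} → p ∈ V₂ → q ∈ V₂ → s₁ ∈ V₁ → s₂ ∈ V₁ →
    IsInduced22 _≺_ s₁ s₂ p q → Outside o → Comparable o p → ¬ Comparable o q → ⊥
  no-outside-separates-22₂ {p} {q} {s₁} {s₂} {o} p∈V₂ q∈V₂ s₁∈V₁ s₂∈V₁
                           (_ , s₂≢q , s₁≺p , s₂≺q , _ , s₁∥q , p∥s₂ , p∥q) o-out o~p o≁q
    with o~p
  ... | inj₂ p≺o = 3+1-free (s₁ , p , o , q , s₁≺p , p≺o , s₁∥q , p∥q , o∥q)
    where o∥q = ¬comparable⇒∥ (Outside⇒≢₂ o-out q∈V₂) o≁q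
  ... | inj₁ o≺p = cannot-join-V₁ o-out o∥V₁ (s₂ , p , q , s₂∈V₁ , p∈V₂ , q∈V₂ , induced22On4 os₂pq #1 #2 #3 #4) o-below-V₂
    where
    o∥q : o ∥ q
    o∥q = ¬comparable⇒∥ (Outside⇒≢₂ o-out q∈V₂) o≁q

    o∥s₂ : o ∥ s₂
    o∥s₂ = Outside⇒≢₁ o-out s₂∈V₁ , (λ o≺s₂ → ∥⇒⊀ o∥q (≺-trans o≺s₂ s₂≺q)) , (λ s₂≺o → ∥⇒⊁ p∥s₂ (≺-trans s₂≺o o≺p))

    os₂pq : IsInduced22 _≺_ o s₂ p q
    os₂pq = ≺⇒≢ o≺p , s₂≢q , o≺p , s₂≺q , o∥s₂ , o∥q , p∥s₂ , p∥q

    o⊀V₁ : ∀ {s} → s ∈ V₁ → ¬ o ≺ s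
    o⊀V₁ {s} s∈V₁ o≺s with below-some-V₂ s∈V₁ | V₁-below-V₂ s q s∈V₁ q∈V₂
    ... | _ , _ , _           | inj₁ s≺q = ∥⇒⊀ o∥q (≺-trans o≺s s≺q)
    ... | r , r∈V₂ , s≺r | inj₂ s∥q with r ≟ᶠ q
    ...   | yes refl = ∥⇒⊀ s∥q s≺r
    ...   | no r≢q   = 3+1-free (o , s , r , q , o≺s , s≺r , o∥q , s∥q , V₂-antichain r q r∈V₂ q∈V₂ r≢q)

    V₁⊀o : ∀ {s} → s ∈ V₁ → ¬ s ≺ o
    V₁⊀o {s} s∈V₁ s≺o with s ≟ᶠ s₂
    ... | yes refl = ∥⇒⊁ o∥s₂ s≺o
    ... | no s≢s₂  = 3+1-free (s , o , p , s₂ , s≺o , o≺p , V₁-antichain s s₂ s∈V₁ s₂∈V₁ s≢s₂ , o∥s₂ , p∥s₂)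

    o∥V₁ : ∀ s → s ∈ V₁ → o ∥ s
    o∥V₁ s s∈V₁ = Outside⇒≢₁ o-out s∈V₁ , o⊀V₁ s∈V₁ , V₁⊀o s∈V₁

    o-below-V₂ : ∀ y → y ∈ V₂ → o ≺ y ⊎ o ∥ y
    o-below-V₂ y y∈V₂ with o ≺? y
    ... | yes o≺y = inj₁ o≺y
    ... | no o⊀y  = inj₂ (Outside⇒≢₂ o-out y∈V₂ , o⊀y , λ y≺o → V₂-⊀ y∈V₂ p∈V₂ (≺-trans y≺o o≺p))

  Outside-comparable-uniform₁ : ∀ {o s s'} → Outside o → s ∈ V₁ → s' ∈ V₁ → Comparable o s → Comparable o s'
  Outside-comparable-uniform₁ {o} {s} {s'} o-out s∈V₁ s'∈V₁ o~s with comparable? o s'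
  ... | yes o~s' = o~s'
  ... | no o≁s' with V₁-separated (comparable? o) s∈V₁ o~s s'∈V₁ o≁s'
  ...   | _ , _ , _ , _ , x∈V₁ , o~x , y∈V₁ , o≁y , z∈V₂ , t∈V₂ , h =
    ⊥-elim (no-outside-separates-22₁ x∈V₁ y∈V₁ z∈V₂ t∈V₂ h o-out o~x o≁y)

  Outside-comparable-uniform₂ : ∀ {o s s'} → Outside o → s ∈ V₂ → s' ∈ V₂ → Comparable o s → Comparable o s'
  Outside-comparable-uniform₂ {o} {s} {s'} o-out s∈V₂ s'∈V₂ o~s with comparable? o s'
  ... | yes o~s' = o~s'
  ... | no o≁s' with V₂-separated (comparable? o) s∈V₂ o~s s'∈V₂ o≁s'
  ...   | _ , _ , _ , _ , x∈V₂ , o~x , y∈V₂ , o≁y , z∈V₁ , t∈V₁ , h =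
    ⊥-elim (no-outside-separates-22₂ x∈V₂ y∈V₂ z∈V₁ t∈V₁ h o-out o~x o≁y)

  Outside-∥-uniform₁ : ∀ {o s s'} → Outside o → s ∈ V₁ → s' ∈ V₁ → o ∥ s → o ∥ s'
  Outside-∥-uniform₁ o-out s∈V₁ s'∈V₁ o∥s =
    ¬comparable⇒∥ (Outside⇒≢₁ o-out s'∈V₁) (∥⇒¬comparable o∥s ∘ Outside-comparable-uniform₁ o-out s'∈V₁ s∈V₁)

  Outside-∥-uniform₂ : ∀ {o s s'} → Outside o → s ∈ V₂ → s' ∈ V₂ → o ∥ s → o ∥ s'
  Outside-∥-uniform₂ o-out s∈V₂ s'∈V₂ o∥s =
    ¬comparable⇒∥ (Outside⇒≢₂ o-out s'∈V₂) (∥⇒¬comparable o∥s ∘ Outside-comparable-uniform₂ o-out s'∈V₂ s∈V₂)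

  -- Otherwise (V₁ ∪ {z}, V₂ ∪ {t}) satisfies (a)–(e), with a, z, c, t an induced (2+2).
  no-outside-chain-beside : ∀ {z t x y} → Outside z → Outside t → z ≺ t → x ∈ V₁ → y ∈ V₂ →
    z ∥ x → z ∥ y → t ∥ x → t ∥ y → ⊥
  no-outside-chain-beside {z} {t} z-out t-out z≺t x∈V₁ y∈V₂ z∥x z∥y t∥x t∥y =
    cannot-join-both z-out z∥V₁ t∥V₂
      (a , c , t , a∈V₁ , p⊆p∪⁅x⁆ c∈V₂ , x∈p∪⁅x⁆ t , induced22On4 azct #2 #1 #3 #4)
      (c , a , z , c∈V₂ , p⊆p∪⁅x⁆ a∈V₁ , x∈p∪⁅x⁆ z , induced22On4 azct #3 #4 #2 #1)
      (λ s s∈V₁ → inj₂ (∥-sym (t∥V₁ s s∈V₁))) (λ s s∈V₂ → inj₂ (z∥V₂ s s∈V₂)) (inj₁ z≺t)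
    where
    z∥V₁ : ∀ s → s ∈ V₁ → z ∥ s
    z∥V₁ s s∈V₁ = Outside-∥-uniform₁ z-out x∈V₁ s∈V₁ z∥x
    z∥V₂ : ∀ s → s ∈ V₂ → z ∥ s
    z∥V₂ s s∈V₂ = Outside-∥-uniform₂ z-out y∈V₂ s∈V₂ z∥y
    t∥V₁ : ∀ s → s ∈ V₁ → t ∥ s
    t∥V₁ s s∈V₁ = Outside-∥-uniform₁ t-out x∈V₁ s∈V₁ t∥x
    t∥V₂ : ∀ s → s ∈ V₂ → t ∥ s
    t∥V₂ s s∈V₂ = Outside-∥-uniform₂ t-out y∈V₂ s∈V₂ t∥y

    azct : IsInduced22 _≺_ a z c t
    azct = let (a≢c , _ , a≺c , _) = abcd in
      a≢c , ≺⇒≢ z≺t , a≺c , z≺t , ∥-sym (z∥V₁ a a∈V₁) , ∥-sym (t∥V₁ a a∈V₁) ,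
      ∥-sym (z∥V₂ c c∈V₂) , ∥-sym (t∥V₂ c c∈V₂)

  -- Otherwise (V₁ ∪ {q}, V₂ ∪ {p}) satisfies (a)–(e), with a, q, p, d an induced (2+2).
  no-outside-pair-between : ∀ {p q x y} → Outside p → Outside q → x ∈ V₁ → y ∈ V₂ → x ≺ p → q ≺ y →
    p ∥ y → q ∥ x → p ∥ q → ⊥
  no-outside-pair-between {p} {q} {x} {y} p-out q-out x∈V₁ y∈V₂ x≺p q≺y p∥y q∥x p∥q =
    cannot-join-both q-out q∥V₁ p∥V₂
      (a , p , d , a∈V₁ , x∈p∪⁅x⁆ p , p⊆p∪⁅x⁆ d∈V₂ , induced22On4 aqpd #2 #1 #3 #4)
      (d , a , q , d∈V₂ , p⊆p∪⁅x⁆ a∈V₁ , x∈p∪⁅x⁆ q , induced22On4 aqpd #3 #4 #1 #2)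
      (λ s s∈V₁ → inj₁ (V₁≺p s∈V₁)) (λ s s∈V₂ → inj₁ (q≺V₂ s∈V₂)) (inj₂ (∥-sym p∥q))
    where
    V₁≺p : ∀ {s} → s ∈ V₁ → s ≺ p
    V₁≺p s∈V₁ with Outside-comparable-uniform₁ p-out x∈V₁ s∈V₁ (inj₂ x≺p)
    ... | inj₁ p≺s = ⊥-elim (V₁-⊀ x∈V₁ s∈V₁ (≺-trans x≺p p≺s))
    ... | inj₂ s≺p = s≺p
    q≺V₂ : ∀ {s} → s ∈ V₂ → q ≺ s
    q≺V₂ s∈V₂ with Outside-comparable-uniform₂ q-out y∈V₂ s∈V₂ (inj₁ q≺y)
    ... | inj₁ q≺s = q≺s
    ... | inj₂ s≺q = ⊥-elim (V₂-⊀ s∈V₂ y∈V₂ (≺-trans s≺q q≺y))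
    q∥V₁ : ∀ s → s ∈ V₁ → q ∥ s
    q∥V₁ s s∈V₁ = Outside-∥-uniform₁ q-out x∈V₁ s∈V₁ q∥x
    p∥V₂ : ∀ s → s ∈ V₂ → p ∥ s
    p∥V₂ s s∈V₂ = Outside-∥-uniform₂ p-out y∈V₂ s∈V₂ p∥y

    aqpd : IsInduced22 _≺_ a q p d
    aqpd = let (_ , _ , _ , _ , _ , a∥d , _) = abcd in
      ≢-sym (Outside⇒≢₁ p-out a∈V₁) , Outside⇒≢₂ q-out d∈V₂ , V₁≺p a∈V₁ , q≺V₂ d∈V₂ ,
      ∥-sym (q∥V₁ a a∈V₁) , a∥d , p∥q , p∥V₂ d d∈V₂

  Inside : Fin N → Set
  Inside x = ¬ Outside x

  ∈V₁⇒Inside : ∀ {x} → x ∈ V₁ → Inside x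
  ∈V₁⇒Inside x∈V₁ (x∉V₁ , _) = x∉V₁ x∈V₁

  ∈V₂⇒Inside : ∀ {x} → x ∈ V₂ → Inside x
  ∈V₂⇒Inside x∈V₂ (_ , x∉V₂) = x∉V₂ x∈V₂

  abcd-Inside : ∀ {u} → OneOf4 u a b c d → Inside u
  abcd-Inside #1 = ∈V₁⇒Inside a∈V₁
  abcd-Inside #2 = ∈V₁⇒Inside b∈V₁
  abcd-Inside #3 = ∈V₂⇒Inside c∈V₂
  abcd-Inside #4 = ∈V₂⇒Inside d∈V₂

  module QOrder {m n : ℕ} (v : Fin m → Fin N) (w : Fin n → Fin N)
    (v∈V₁ : ∀ i → v i ∈ V₁) (w∈V₂ : ∀ j → w j ∈ V₂) (w-onto : ∀ y → y ∈ V₂ → ∃ λ j → w j ≡ y)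
    (k : ℕ) where

    _<Q_ : BinRel N
    _<Q_ = QRel _≺_ V₁ V₂ v w k

    _∥Q_ : Fin N → Fin N → Set
    _∥Q_ = Incomp _<Q_

    ComparableQ : Fin N → Fin N → Set
    ComparableQ x y = x <Q y ⊎ y <Q x

    open Incomparability _<Q_ using ()
      renaming (Incomp-sym to ∥Q-sym; Incomp⇒≢ to ∥Q⇒≢; Incomp⇒¬R to ∥Q⇒≮Q; IsInduced22-swap to IsInduced22Q-swap)

    <Q⇒≺ : ∀ {x y} → Outside x ⊎ Outside y → x <Q y → x ≺ y
    <Q⇒≺ _             (inj₁ (_ , x≺y))               = x≺y
    <Q⇒≺ (inj₁ x-out) (inj₂ (i , _ , refl , _ , _)) = ⊥-elim (proj₁ x-out (v∈V₁ i))
    <Q⇒≺ (inj₂ y-out) (inj₂ (_ , j , _ , refl , _)) = ⊥-elim (proj₂ y-out (w∈V₂ j))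

    ∥Q⇒∥ : ∀ {x y} → Outside x ⊎ Outside y → x ∥Q y → x ∥ y
    ∥Q⇒∥ x/y-out (x≢y , x≮y , y≮x) = x≢y , (λ x≺y → x≮y (inj₁ (x/y-out , x≺y))) , (λ y≺x → y≮x (inj₁ (swap x/y-out , y≺x)))

    ComparableQ⇒Comparable : ∀ {x p} → Outside p → ComparableQ x p → Comparable p x
    ComparableQ⇒Comparable p-out (inj₁ x<p) = inj₂ (<Q⇒≺ (inj₂ p-out) x<p)
    ComparableQ⇒Comparable p-out (inj₂ p<x) = inj₁ (<Q⇒≺ (inj₁ p-out) p<x)

    <Q-inside : ∀ {x y} → x <Q y → Inside x → Inside y → ∃₂ λ i j → v i ≡ x × w j ≡ y × k ≤ toℕ i
    <Q-inside (inj₁ (inj₁ x-out , _)) x-in _    = ⊥-elim (x-in x-out)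
    <Q-inside (inj₁ (inj₂ y-out , _)) _    y-in = ⊥-elim (y-in y-out)
    <Q-inside (inj₂ x<y)              _    _    = x<y

    ⊀Q-V₁ : ∀ {x y} → Inside x → y ∈ V₁ → ¬ x <Q y
    ⊀Q-V₁ x-in y∈V₁ x<y with <Q-inside x<y x-in (∈V₁⇒Inside y∈V₁)
    ... | _ , j , _ , refl , _ = V₁∩V₂-empty y∈V₁ (w∈V₂ j)

    V₂-⊀Q : ∀ {x y} → x ∈ V₂ → Inside y → ¬ x <Q y
    V₂-⊀Q x∈V₂ y-in x<y with <Q-inside x<y (∈V₂⇒Inside x∈V₂) y-in
    ... | i , _ , refl , _ , _ = V₁∩V₂-empty (v∈V₁ i) x∈V₂

    -- Between the blocks, x <Q y depends only on x.
    <Q-to-all-V₂ : ∀ {x p y} → x <Q p → Inside x → Inside p → y ∈ V₂ → x <Q y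
    <Q-to-all-V₂ {y = y} x<p x-in p-in y∈V₂ with <Q-inside x<p x-in p-in | w-onto y y∈V₂
    ... | i , _ , vi≡x , _ , k≤i | j , wj≡y = inj₂ (i , j , vi≡x , wj≡y , k≤i)

    <Q-into-V₁ : ∀ {u t} → u <Q t → t ∈ V₁ → Outside u × u ≺ t
    <Q-into-V₁ (inj₁ (inj₁ u-out , u≺t)) _ = u-out , u≺t
    <Q-into-V₁ (inj₁ (inj₂ t-out , _))  t∈V₁ = ⊥-elim (proj₁ t-out t∈V₁)
    <Q-into-V₁ (inj₂ (_ , j , _ , refl , _)) t∈V₁ = ⊥-elim (V₁∩V₂-empty t∈V₁ (w∈V₂ j))

    -- If x <Q y were a new relation, x and y would be P-incomparable, and then
    -- u <Q t is impossible wherever t and u lie.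
    induced22Q⇒≺ : ∀ {x u y t} → IsInduced22 _<Q_ x u y t → x ≺ y
    induced22Q⇒≺ (_ , _ , inj₁ (_ , x≺y) , _) = x≺y
    induced22Q⇒≺ {x} {u} {y} {t} (_ , _ , x<y@(inj₂ (i , j , refl , refl , _)) , u<t , x∥u , x∥t , y∥u , y∥t)
      with V₁-below-V₂ x y (v∈V₁ i) (w∈V₂ j)
    ... | inj₁ x≺y = x≺y
    ... | inj₂ _   = ⊥-elim (u<t-impossible (block t))
      where
      x∈V₁ = v∈V₁ i
      y∈V₂ = w∈V₂ j

      u<t-impossible : Block t → ⊥
      u<t-impossible (in-V₂ t∈V₂) = ∥Q⇒≮Q x∥t (<Q-to-all-V₂ x<y (∈V₁⇒Inside x∈V₁) (∈V₂⇒Inside y∈V₂) t∈V₂)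
      u<t-impossible (in-V₁ t∈V₁) with <Q-into-V₁ u<t t∈V₁
      ... | u-out , u≺t = ∥⇒¬comparable (∥Q⇒∥ (inj₁ u-out) (∥Q-sym x∥u))
                            (Outside-comparable-uniform₁ u-out t∈V₁ x∈V₁ (inj₁ u≺t))
      u<t-impossible (out t-out) with block u
      ... | in-V₁ u∈V₁ = ∥⇒¬comparable (∥Q⇒∥ (inj₁ t-out) (∥Q-sym x∥t))
                           (Outside-comparable-uniform₁ t-out u∈V₁ x∈V₁ (inj₂ (<Q⇒≺ (inj₂ t-out) u<t)))
      ... | in-V₂ u∈V₂ = ∥⇒¬comparable (∥Q⇒∥ (inj₁ t-out) (∥Q-sym y∥t))
                           (Outside-comparable-uniform₂ t-out u∈V₂ y∈V₂ (inj₂ (<Q⇒≺ (inj₂ t-out) u<t)))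
      ... | out u-out  = no-outside-chain-beside u-out t-out (<Q⇒≺ (inj₁ u-out) u<t) x∈V₁ y∈V₂
                           (∥Q⇒∥ (inj₁ u-out) (∥Q-sym x∥u)) (∥Q⇒∥ (inj₁ u-out) (∥Q-sym y∥u))
                           (∥Q⇒∥ (inj₁ t-out) (∥Q-sym x∥t)) (∥Q⇒∥ (inj₁ t-out) (∥Q-sym y∥t))

    -- x, y are Q-incomparable corners of a Q-(2+2) whose other corners are p and q.
    cross-∥Q⇒⊀ : ∀ {x y p q} → x ∈ V₁ → y ∈ V₂ → x ∥Q y → ComparableQ x p → ComparableQ y q →
      p ∥Q y → q ∥Q x → p ∥Q q → ¬ x ≺ y
    cross-∥Q⇒⊀ {x} {y} {p} {q} x∈V₁ y∈V₂ x∥y x~p y~q p∥y q∥x p∥q x≺y with block p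
    ... | in-V₁ p∈V₁ = [ ⊀Q-V₁ (∈V₁⇒Inside x∈V₁) p∈V₁ , ⊀Q-V₁ (∈V₁⇒Inside p∈V₁) x∈V₁ ] x~p
    ... | in-V₂ p∈V₂ = [ (λ x<p → ∥Q⇒≮Q x∥y (<Q-to-all-V₂ x<p (∈V₁⇒Inside x∈V₁) (∈V₂⇒Inside p∈V₂) y∈V₂))
                       , V₂-⊀Q p∈V₂ (∈V₁⇒Inside x∈V₁) ] x~p
    ... | out p-out with block q
    ...   | in-V₂ q∈V₂ = [ V₂-⊀Q y∈V₂ (∈V₂⇒Inside q∈V₂) , V₂-⊀Q q∈V₂ (∈V₂⇒Inside y∈V₂) ] y~q
    ...   | in-V₁ q∈V₁ = ∥⇒¬comparable (∥Q⇒∥ (inj₁ p-out) p∥q)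
                           (Outside-comparable-uniform₁ p-out x∈V₁ q∈V₁ (ComparableQ⇒Comparable p-out x~p))
    ...   | out q-out  = no-outside-pair-between p-out q-out x∈V₁ y∈V₂ x≺p q≺y p∥y' q∥x' (∥Q⇒∥ (inj₁ p-out) p∥q)
      where
      p∥y' = ∥Q⇒∥ (inj₁ p-out) p∥y
      q∥x' = ∥Q⇒∥ (inj₁ q-out) q∥x

      x≺p : x ≺ p
      x≺p with ComparableQ⇒Comparable p-out x~p
      ... | inj₁ p≺x = ⊥-elim (∥⇒⊀ p∥y' (≺-trans p≺x x≺y))
      ... | inj₂ x≺p = x≺p

      q≺y : q ≺ y
      q≺y with ComparableQ⇒Comparable q-out y~q
      ... | inj₁ q≺y = q≺y
      ... | inj₂ y≺q = ⊥-elim (∥⇒⊁ q∥x' (≺-trans x≺y y≺q))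

    -- u, u' are Q-incomparable corners of a Q-(2+2) whose other corners are p and p'.
    ∥Q-in-22⇒∥ : ∀ {u u' p p'} → u ∥Q u' → ComparableQ u p → ComparableQ u' p' →
      p ∥Q u' → p' ∥Q u → p ∥Q p' → u ∥ u'
    ∥Q-in-22⇒∥ {u} {u'} u∥u' u~p u'~p' p∥u' p'∥u p∥p' with block u | block u'
    ... | out u-out  | _           = ∥Q⇒∥ (inj₁ u-out) u∥u'
    ... | in-V₁ _    | out u'-out  = ∥Q⇒∥ (inj₂ u'-out) u∥u'
    ... | in-V₂ _    | out u'-out  = ∥Q⇒∥ (inj₂ u'-out) u∥u'
    ... | in-V₁ u∈V₁ | in-V₁ u'∈V₁ = V₁-antichain u u' u∈V₁ u'∈V₁ (∥Q⇒≢ u∥u')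
    ... | in-V₂ u∈V₂ | in-V₂ u'∈V₂ = V₂-antichain u u' u∈V₂ u'∈V₂ (∥Q⇒≢ u∥u')
    ... | in-V₁ u∈V₁ | in-V₂ u'∈V₂ =
      ∥Q⇒≢ u∥u' , cross-∥Q⇒⊀ u∈V₁ u'∈V₂ u∥u' u~p u'~p' p∥u' p'∥u p∥p' , V₂⊀V₁ u∈V₁ u'∈V₂
    ... | in-V₂ u∈V₂ | in-V₁ u'∈V₁ =
      ∥Q⇒≢ u∥u' , V₂⊀V₁ u'∈V₁ u∈V₂ , cross-∥Q⇒⊀ u'∈V₁ u∈V₂ (∥Q-sym u∥u') u'~p' u~p p'∥u p∥u' (∥Q-sym p∥p')

    induced22Q⇒induced22 : ∀ {x y z t} → IsInduced22 _<Q_ x y z t → IsInduced22 _≺_ x y z t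
    induced22Q⇒induced22 h@(x≢z , y≢t , x<z , y<t , x∥y , x∥t , z∥y , z∥t) =
      x≢z , y≢t , induced22Q⇒≺ h , induced22Q⇒≺ (IsInduced22Q-swap h) ,
      ∥Q-in-22⇒∥ x∥y (inj₁ x<z) (inj₁ y<t) z∥y (∥Q-sym x∥t) z∥t ,
      ∥Q-in-22⇒∥ x∥t (inj₁ x<z) (inj₂ y<t) z∥t (∥Q-sym x∥y) z∥y ,
      ∥Q-in-22⇒∥ z∥y (inj₂ x<z) (inj₁ y<t) x∥y (∥Q-sym z∥t) x∥t ,
      ∥Q-in-22⇒∥ z∥t (inj₂ x<z) (inj₂ y<t) x∥t (∥Q-sym z∥y) x∥y

    -- x <Q z and y <Q t force x <Q t.
    ¬induced22Q-inside : ∀ {x y z t} → Inside x → Inside y → Inside z → Inside t → ¬ IsInduced22 _<Q_ x y z t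
    ¬induced22Q-inside x-in y-in z-in t-in (_ , _ , x<z , y<t , _ , x∥t , _)
      with <Q-inside x<z x-in z-in | <Q-inside y<t y-in t-in
    ... | i , _ , vi≡x , _ , k≤i | _ , j , _ , wj≡t , _ = ∥Q⇒≮Q x∥t (inj₂ (i , j , vi≡x , wj≡t , k≤i))

    ¬Induced22On-abcd : ¬ Induced22On _<Q_ (fourSet a b c d)
    ¬Induced22On-abcd (_ , _ , _ , _ , x∈ , y∈ , z∈ , t∈ , h) =
      ¬induced22Q-inside (abcd-Inside (∈fourSet⁻ x∈)) (abcd-Inside (∈fourSet⁻ y∈))
                         (abcd-Inside (∈fourSet⁻ z∈)) (abcd-Inside (∈fourSet⁻ t∈)) h

lemma5p15 : (N : ℕ) (_<P_ : Fin N → Fin N → Set) →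
    IsStrictPartialOrder _≡_ _<P_ → (<P? : DecRel _<P_) → ThreeOneFree _<P_ →
    (a b c d : Fin N) → IsInduced22 _<P_ a b c d →
    (V₁ V₂ : Subset N) → MaximalPair _<P_ a b c d V₁ V₂ →
    (m n : ℕ) (v : Fin m → Fin N) (w : Fin n → Fin N) →
    Enumerates V₁ v → Enumerates V₂ w →
    (k : ℕ) → k ≤ m →
    count22 (QRel? <P? V₁ V₂ v w k) < count22 <P?
lemma5p15 N _<P_ spo <P? 3+1-free a b c d abcd V₁ V₂
          (((a∈V₁ , b∈V₁ , c∈V₂ , d∈V₂) , V₁-antichain , V₂-antichain , V₁-split , V₂-split , V₁-below-V₂) , maximality)
          m n v w (_ , v-enumerates) (_ , w-enumerates) k _ =
  count22-< <P? (QRel? <P? V₁ V₂ v w k) induced22Q⇒induced22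
    (IsInduced22⇒∣fourSet∣≡4 abcd) (IsInduced22⇒Induced22On abcd) ¬Induced22On-abcd
  where
  open Incomparability _<P_
  open MaximalPairProperties spo <P? 3+1-free abcd a∈V₁ b∈V₁ c∈V₂ d∈V₂
         V₁-antichain V₂-antichain V₁-split V₂-split V₁-below-V₂ maximality
  open QOrder v w (λ i → Equivalence.from (v-enumerates (v i)) (i , refl))
                  (λ j → Equivalence.from (w-enumerates (w j)) (j , refl))
                  (λ y → Equivalence.to (w-enumerates y)) k
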